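{- For the complete graph $K_n$, $$\vartheta(K_n)=\begin{cases}\frac{1}{4}n(n-2) & \text{if } n \text{ is even},\\ \frac{1}{4}(n-1)^2 & \text{if } n \text{ is odd}.\end{cases}$$
   Context: An integer additive set-indexer (IASI) of a graph $G$ is an injective map $f:V(G)\to\mathcal{P}(\mathbb{N}_0)$ (finite subsets of non-negative integers) such that $f^+(uv)=f(u)+f(v)=\{a+b:a\in f(u),b\in f(v)\}$ is injective on $E(G)$. An AP-set is a set of at least three non-negative integers in arithmetic progression; its common difference is its deterministic index. An arithmetic IASI (AIASI) is an IASI for which all vertex and edge set-labels are AP-sets. For an edge, the integer ratio between the deterministic indices of its end vertices (larger over smaller) is its deterministic ratio. The dispensing number $\vartheta(G)$ is the minimum possible number of edges of $G$ that do not have a prime deterministic ratio (minimum over arithmetic IASIs of $G$). -}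

module Defs where

open import Data.Nat using (ℕ; zero; suc; _+_; _*_; _∸_; _≤_; _<_; s≤s; _<?_)
open import Data.Nat.Properties using (_≟_; m≤m*n; *-zeroʳ)
open import Data.Nat.Primality using (Prime; prime?; prime[2])
open import Data.Fin using (Fin; toℕ; fromℕ<)
open import Data.Fin.Properties using (any?; toℕ-fromℕ<)
open import Data.List using (List; length; filter; concatMap; map; allFin)
open import Data.Product using (Σ; ∃; ∃-syntax; _×_; _,_; proj₁; proj₂)
open import Data.Sum using (_⊎_; inj₁; inj₂)
open import Relation.Nullary using (Dec; yes; no; ¬_)
open import Relation.Nullary.Decidable using (_×-dec_; _⊎-dec_; ¬?)
open import Relation.Binary.PropositionalEquality using (_≡_; refl; sym; trans; subst)
open import Function.Bundles using (_⇔_)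

record APSet : Set where
  constructor ap
  field
    start  : ℕ
    diff   : ℕ      -- the common difference (deterministic index)
    len    : ℕ
    diff≥1 : 1 ≤ diff
    len≥3  : 3 ≤ len

open APSet public

_∈AP_ : ℕ → APSet → Set
x ∈AP A = ∃[ i ] (i < len A × x ≡ start A + i * diff A)

SetN : Set₁
SetN = ℕ → Set

_≐_ : SetN → SetN → Set
S ≐ T = ∀ x → S x ⇔ T x

SumSet : APSet → APSet → SetN
SumSet A B x = ∃[ a ] ∃[ b ] (a ∈AP A × b ∈AP B × x ≡ a + b)

IsEdge : ∀ {n} → Fin n → Fin n → Set
IsEdge u v = toℕ u < toℕ v

record IsAIASI (n : ℕ) (f : Fin n → APSet) : Set where
  field
    vertex-inj : ∀ u v → (λ x → x ∈AP f u) ≐ (λ x → x ∈AP f v) → u ≡ v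
    edge-inj   : ∀ u v u' v' → IsEdge u v → IsEdge u' v' →
                 SumSet (f u) (f v) ≐ SumSet (f u') (f v') → (u ≡ u' × v ≡ v')
    edge-AP    : ∀ u v → IsEdge u v →
                 ∃[ A ] (SumSet (f u) (f v) ≐ (λ x → x ∈AP A))

IsPrimeMultiple : ℕ → ℕ → Set
IsPrimeMultiple m d = ∃[ p ] (Prime p × m ≡ p * d)

PrimeRatio : ℕ → ℕ → Set
PrimeRatio d e = IsPrimeMultiple e d ⊎ IsPrimeMultiple d e

isPrimeMultiple? : ∀ m d → Dec (IsPrimeMultiple m d)
isPrimeMultiple? zero zero = yes (2 , prime[2] , refl)
isPrimeMultiple? (suc m) zero = no λ { (p , _ , eq) → absurd (trans eq (*-zeroʳ p)) }
  where
  absurd : suc m ≡ 0 → _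
  absurd ()
isPrimeMultiple? m (suc k) with any? {n = suc m} (λ i → prime? (toℕ i) ×-dec (m ≟ toℕ i * suc k))
... | yes (i , pr , eq) = yes (toℕ i , pr , eq)
... | no ¬w = no λ { (p , pr , eq) →
        let lt = s≤s (subst (p ≤_) (sym eq) (m≤m*n p (suc k))) in
        ¬w (fromℕ< lt
           , subst Prime (sym (toℕ-fromℕ< lt)) pr
           , subst (λ q → m ≡ q * suc k) (sym (toℕ-fromℕ< lt)) eq) }

primeRatio? : ∀ d e → Dec (PrimeRatio d e)
primeRatio? d e = isPrimeMultiple? e d ⊎-dec isPrimeMultiple? d e

allPairs : (n : ℕ) → List (Σ (Fin n) (λ _ → Fin n))
allPairs n = concatMap (λ u → map (λ v → (u , v)) (allFin n)) (allFin n)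

nonPrimeEdges : (n : ℕ) → (Fin n → APSet) → ℕ
nonPrimeEdges n f =
  length (filter (λ uv → (toℕ (proj₁ uv) <? toℕ (proj₂ uv))
                         ×-dec ¬? (primeRatio? (diff (f (proj₁ uv))) (diff (f (proj₂ uv)))))
                 (allPairs n))

IsDispensingNumberK : ℕ → ℕ → Set
IsDispensingNumberK n k =
  (∃[ f ] (IsAIASI n f × nonPrimeEdges n f ≡ k)) ×
  (∀ f → IsAIASI n f → k ≤ nonPrimeEdges n f)

module Submission where

-- Let minMono n be the least number of monochromatic edges of a 2-colouring
-- of Kₙ; it satisfies minMono (n + 2) = minMono n + n, and 4 · minMono n is
-- n(n-2) for even n and (n-1)² for odd n.  We prove ϑ(Kₙ) = minMono n.
--
-- Lower bound.  Colour each vertex by the parity of Ω(d), the number of prime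
-- factors (with multiplicity) of its deterministic index d.  If e = p·d with p
-- prime then Ω(e) = Ω(d) + 1, so an edge with prime deterministic ratio is
-- bichromatic.  Hence every monochromatic edge is counted by the dispensing
-- number, and classes of sizes a and b give (a choose 2) + (b choose 2)
-- ≥ minMono (a + b) monochromatic edges.  This needs no injectivity at all.
--
-- Upper bound.  Label vertex i by {2ⁱ, 2ⁱ + d, 2ⁱ + 2d}, with d = 1 for even i
-- and d = 2 for odd i.  Sums of these sets are AP-sets, every set-label is
-- recovered from its least element, and 2ᵘ + 2ᵛ determines u < v, so this is
-- an AIASI.  Its non-prime edges are those joining vertices of equal parity,
-- and the parity colouring is balanced, so it has exactly minMono n of them.

open import Defs
open import Data.Nat using (ℕ; zero; suc; _+_; _*_; _∸_; _^_; _/_; _%_; _≤_; _<_; z≤n; s≤s; s≤s⁻¹; z<s; s<s; s<s⁻¹; _<?_; parity)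
open import Data.Nat.Properties hiding (_≟_)
open import Data.Nat.DivMod using (m≡m%n+[m/n]*n; m*n/n≡m)
open import Data.Nat.Tactic.RingSolver using (solve-∀)
open import Data.Nat.Primality using (Prime; prime[2]; ¬prime[0]; ¬prime[1])
open import Data.Nat.Primality.Factorisation using (PrimeFactorisation; factorise; factors; factorisationUnique)
open import Data.Parity.Base using (Parity; 0ℙ; 1ℙ; _⁻¹)
open import Data.Parity.Properties using (_≟_; p≢p⁻¹; suc-homo-⁻¹)
open import Data.Fin using (Fin; toℕ; zero; suc)
open import Data.Fin.Properties using (toℕ-injective)
open import Data.List using (List; _∷_; _++_; length; filter; concatMap; map; tabulate)
open import Data.List.Properties using (filter-++; length-++; map-tabulate)
open import Data.List.Relation.Binary.Permutation.Propositional.Properties using (↭-length)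
open import Data.List.Relation.Unary.All using (_∷_)
open import Data.Product using (∃-syntax; _×_; _,_; proj₁; proj₂)
open import Data.Product as Product using ()
open import Data.Sum using (inj₁; inj₂; [_,_])
open import Function using (_∘_; id)
open import Function.Bundles using (Equivalence; mk⇔)
open import Function.Construct.Composition using (_⇔-∘_)
open import Relation.Binary.Definitions using (tri<; tri≈; tri>)
open import Relation.Binary.PropositionalEquality using (_≡_; _≢_; refl; sym; trans; cong; cong₂; subst; subst₂; module ≡-Reasoning)
open import Relation.Nullary using (Dec; yes; no; ¬_; contradiction)
open import Relation.Nullary.Decidable using (_×-dec_; ¬?)
open import Relation.Unary using (Decidable)
open import Algebra.Properties.Monoid.Sum +-0-monoid using (sum-syntax; sum-cong-≗)

𝟙 : {P : Set} → Dec P → ℕ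
𝟙 (yes _) = 1
𝟙 (no _) = 0

𝟙-mono : {P Q : Set} → (P → Q) → (p? : Dec P) (q? : Dec Q) → 𝟙 p? ≤ 𝟙 q?
𝟙-mono _ (no _) _ = z≤n
𝟙-mono _ (yes _) (yes _) = ≤-refl
𝟙-mono P⇒Q (yes p) (no ¬q) = contradiction (P⇒Q p) ¬q

𝟙-no : {P : Set} → ¬ P → (p? : Dec P) → 𝟙 p? ≡ 0
𝟙-no ¬p (yes p) = contradiction p ¬p
𝟙-no _ (no _) = refl

∑-mono : ∀ n {g h : Fin n → ℕ} → (∀ i → g i ≤ h i) → ∑[ i < n ] g i ≤ ∑[ i < n ] h i
∑-mono zero _ = z≤n
∑-mono (suc n) g≤h = +-mono-≤ (g≤h zero) (∑-mono n (g≤h ∘ suc))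

count : ∀ n {P : Fin n → Set} → (∀ i → Dec (P i)) → ℕ
count n P? = ∑[ i < n ] 𝟙 (P? i)

count-mono : ∀ n {P Q : Fin n → Set} (P? : ∀ i → Dec (P i)) (Q? : ∀ i → Dec (Q i)) →
             (∀ i → P i → Q i) → count n P? ≤ count n Q?
count-mono n P? Q? P⇒Q = ∑-mono n (λ i → 𝟙-mono (P⇒Q i) (P? i) (Q? i))

count-cong : ∀ n {P Q : Fin n → Set} (P? : ∀ i → Dec (P i)) (Q? : ∀ i → Dec (Q i)) →
             (∀ i → P i → Q i) → (∀ i → Q i → P i) → count n P? ≡ count n Q?
count-cong n P? Q? P⇒Q Q⇒P = ≤-antisym (count-mono n P? Q? P⇒Q) (count-mono n Q? P? Q⇒P)

edgeCount : ∀ n {R : Fin n → Fin n → Set} → (∀ u v → Dec (R u v)) → ℕ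
edgeCount n R? = ∑[ u < n ] count n (λ v → (toℕ u <? toℕ v) ×-dec R? u v)

edgeCount-mono : ∀ n {R Q : Fin n → Fin n → Set} (R? : ∀ u v → Dec (R u v)) (Q? : ∀ u v → Dec (Q u v)) →
                 (∀ u v → R u v → Q u v) → edgeCount n R? ≤ edgeCount n Q?
edgeCount-mono n R? Q? R⇒Q = ∑-mono n (λ u → count-mono n _ _ (λ v → Product.map₂ (R⇒Q u v)))

edgeCount-cong : ∀ n {R Q : Fin n → Fin n → Set} (R? : ∀ u v → Dec (R u v)) (Q? : ∀ u v → Dec (Q u v)) →
                 (∀ u v → R u v → Q u v) → (∀ u v → Q u v → R u v) → edgeCount n R? ≡ edgeCount n Q?
edgeCount-cong n R? Q? R⇒Q Q⇒R = ≤-antisym (edgeCount-mono n R? Q? R⇒Q) (edgeCount-mono n Q? R? Q⇒R)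

edgeCount-suc : ∀ n {R : Fin (suc n) → Fin (suc n) → Set} (R? : ∀ u v → Dec (R u v)) →
                edgeCount (suc n) R? ≡ count n (λ v → R? zero (suc v)) + edgeCount n (λ u v → R? (suc u) (suc v))
edgeCount-suc n R? = cong₂ _+_ edgesOfZero (sum-cong-≗ edgesOfSuc)
  where
  edgesOfZero : count (suc n) (λ v → (0 <? toℕ v) ×-dec R? zero v) ≡ count n (λ v → R? zero (suc v))
  edgesOfZero = cong₂ _+_ (𝟙-no (λ { (() , _) }) ((0 <? 0) ×-dec R? zero zero))
    (count-cong n (λ v → (0 <? toℕ (suc v)) ×-dec R? zero (suc v))
                  (λ v → R? zero (suc v))
                  (λ _ → proj₂) (λ _ r → z<s , r))
  edgesOfSuc : ∀ u → count (suc n) (λ v → (toℕ (suc u) <? toℕ v) ×-dec R? (suc u) v)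
                   ≡ count n (λ v → (toℕ u <? toℕ v) ×-dec R? (suc u) (suc v))
  edgesOfSuc u = cong₂ _+_ (𝟙-no (λ { (() , _) }) ((toℕ (suc u) <? 0) ×-dec R? (suc u) zero))
    (count-cong n (λ v → (toℕ (suc u) <? toℕ (suc v)) ×-dec R? (suc u) (suc v))
                  (λ v → (toℕ u <? toℕ v) ×-dec R? (suc u) (suc v))
                  (λ _ → Product.map₁ s<s⁻¹) (λ _ → Product.map₁ s<s))

filter-tabulate : ∀ {A : Set} {P : A → Set} (P? : Decidable P) n (g : Fin n → A) →
                  length (filter P? (tabulate g)) ≡ count n (λ i → P? (g i))
filter-tabulate P? zero g = refl
filter-tabulate P? (suc n) g with P? (g zero)
... | yes _ = cong suc (filter-tabulate P? n (g ∘ suc))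
... | no _ = filter-tabulate P? n (g ∘ suc)

filter-concatMap : ∀ {A B : Set} {P : B → Set} (P? : Decidable P) (k : A → List B) n (g : Fin n → A) →
                   length (filter P? (concatMap k (tabulate g))) ≡ ∑[ i < n ] length (filter P? (k (g i)))
filter-concatMap P? k zero g = refl
filter-concatMap P? k (suc n) g = begin
    length (filter P? (k (g zero) ++ rest))
      ≡⟨ cong length (filter-++ P? (k (g zero)) rest) ⟩
    length (filter P? (k (g zero)) ++ filter P? rest)
      ≡⟨ length-++ (filter P? (k (g zero))) ⟩
    length (filter P? (k (g zero))) + length (filter P? rest)
      ≡⟨ cong (_ +_) (filter-concatMap P? k n (g ∘ suc)) ⟩
    ∑[ i < suc n ] length (filter P? (k (g i))) ∎
  where
  open ≡-Reasoning
  rest = concatMap k (tabulate (g ∘ suc))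

allPairs-edgeCount : ∀ n {R : Fin n → Fin n → Set} (R? : ∀ u v → Dec (R u v)) →
  length (filter (λ uv → (toℕ (proj₁ uv) <? toℕ (proj₂ uv)) ×-dec R? (proj₁ uv) (proj₂ uv)) (allPairs n))
  ≡ edgeCount n R?
allPairs-edgeCount n R? = trans (filter-concatMap E? _ n id) (sum-cong-≗ λ u →
    trans (cong (length ∘ filter E?) (map-tabulate id (u ,_))) (filter-tabulate E? n (u ,_)))
  where
  E? = λ uv → (toℕ (proj₁ uv) <? toℕ (proj₂ uv)) ×-dec R? (proj₁ uv) (proj₂ uv)

nonPrimeEdges-edgeCount : ∀ n f →
  nonPrimeEdges n f ≡ edgeCount n (λ u v → ¬? (primeRatio? (diff (f u)) (diff (f v))))
nonPrimeEdges-edgeCount n f = allPairs-edgeCount n _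

Colouring : ℕ → Set
Colouring n = Fin n → Parity

classSize : ∀ {n} → Parity → Colouring n → ℕ
classSize {n} c col = count n (λ i → c ≟ col i)

monochromatic : ∀ {n} (col : Colouring n) u v → Dec (col u ≡ col v)
monochromatic col u v = col u ≟ col v

pairs : ℕ → ℕ
pairs zero = 0
pairs (suc a) = pairs a + a

classes-partition : ∀ n (col : Colouring n) → classSize 0ℙ col + classSize 1ℙ col ≡ n
classes-partition zero col = refl
classes-partition (suc n) col = addVertex (col zero)
  where
  ih = classes-partition n (col ∘ suc)
  addVertex : ∀ c → (𝟙 (0ℙ ≟ c) + classSize 0ℙ (col ∘ suc)) + (𝟙 (1ℙ ≟ c) + classSize 1ℙ (col ∘ suc)) ≡ suc n
  addVertex 0ℙ = cong suc ih
  addVertex 1ℙ = trans (+-suc _ _) (cong suc ih)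

monochromatic-count : ∀ n (col : Colouring n) →
  edgeCount n (monochromatic col) ≡ pairs (classSize 0ℙ col) + pairs (classSize 1ℙ col)
monochromatic-count zero col = refl
monochromatic-count (suc n) col = begin
    edgeCount (suc n) (monochromatic col)
      ≡⟨ edgeCount-suc n (monochromatic col) ⟩
    count n (λ v → col zero ≟ col (suc v)) + edgeCount n (monochromatic (col ∘ suc))
      ≡⟨ cong (count n (λ v → col zero ≟ col (suc v)) +_) (monochromatic-count n (col ∘ suc)) ⟩
    count n (λ v → col zero ≟ col (suc v)) + (pairs s₀ + pairs s₁)
      ≡⟨ addVertex (col zero) ⟩
    pairs (classSize 0ℙ col) + pairs (classSize 1ℙ col) ∎
  where
  open ≡-Reasoning
  s₀ = classSize 0ℙ (col ∘ suc)
  s₁ = classSize 1ℙ (col ∘ suc)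
  addVertex : ∀ c → count n (λ v → c ≟ col (suc v)) + (pairs s₀ + pairs s₁)
                  ≡ pairs (𝟙 (0ℙ ≟ c) + s₀) + pairs (𝟙 (1ℙ ≟ c) + s₁)
  addVertex 0ℙ = addFirst s₀ (pairs s₀) (pairs s₁)
    where
    addFirst : ∀ s p q → s + (p + q) ≡ (p + s) + q
    addFirst = solve-∀
  addVertex 1ℙ = addSecond s₁ (pairs s₀) (pairs s₁)
    where
    addSecond : ∀ s p q → s + (p + q) ≡ p + (q + s)
    addSecond = solve-∀

-- minMono n: the least number of monochromatic edges of a 2-colouring of Kₙ
-- (attained by classes of sizes ⌊n/2⌋ and ⌈n/2⌉).
minMono : ℕ → ℕ
minMono 0 = 0
minMono 1 = 0
minMono (suc (suc n)) = minMono n + n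

interchange : ∀ a b c d → (a + b) + (c + d) ≡ (a + c) + (b + d)
interchange = solve-∀

minMono≤pairs : ∀ n → minMono n ≤ pairs n
minMono≤pairs 0 = z≤n
minMono≤pairs 1 = z≤n
minMono≤pairs (suc (suc n)) =
  ≤-trans (+-monoˡ-≤ n (minMono≤pairs n)) (m≤m+n (pairs n + n) (suc n))

-- Any split of the vertices into two classes has at least minMono
-- monochromatic edges: take one vertex out of each class and induct.
minMono≤split : ∀ a b → minMono (a + b) ≤ pairs a + pairs b
minMono≤split zero b = minMono≤pairs b
minMono≤split a@(suc _) zero =
  subst₂ (λ m k → minMono m ≤ k) (sym (+-identityʳ a)) (sym (+-identityʳ (pairs a))) (minMono≤pairs a)
minMono≤split (suc a) (suc b) rewrite +-suc a b = begin
    minMono (a + b) + (a + b)       ≤⟨ +-monoˡ-≤ (a + b) (minMono≤split a b) ⟩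
    (pairs a + pairs b) + (a + b)   ≡⟨ interchange (pairs a) (pairs b) a b ⟩
    (pairs a + a) + (pairs b + b)   ∎
  where open ≤-Reasoning

parityColouring : ∀ n → Colouring n
parityColouring n i = parity (toℕ i)

-- The parity colouring attains minMono: adding two vertices, one per class,
-- adds s₀ + s₁ = n monochromatic edges, matching minMono (n + 2) = minMono n + n.
parityColouring-optimal : ∀ n →
  pairs (classSize 0ℙ (parityColouring n)) + pairs (classSize 1ℙ (parityColouring n)) ≡ minMono n
parityColouring-optimal 0 = refl
parityColouring-optimal 1 = refl
parityColouring-optimal (suc (suc n)) = begin
    (pairs s₀ + s₀) + (pairs s₁ + s₁)   ≡⟨ interchange (pairs s₀) s₀ (pairs s₁) s₁ ⟩
    (pairs s₀ + pairs s₁) + (s₀ + s₁)   ≡⟨ cong₂ _+_ (parityColouring-optimal n) (classes-partition n (parityColouring n)) ⟩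
    minMono n + n                       ∎
  where
  open ≡-Reasoning
  s₀ = classSize 0ℙ (parityColouring n)
  s₁ = classSize 1ℙ (parityColouring n)

minMono-even : ∀ m → minMono (m * 2) * 4 ≡ m * 2 * (m * 2 ∸ 2)
minMono-even zero = refl
minMono-even (suc m) = positive m
  where
  step : ∀ k → suc k * 2 * (k * 2) + suc k * 2 * 4 ≡ suc (suc k) * 2 * (suc k * 2)
  step = solve-∀
  positive : ∀ k → minMono (suc k * 2) * 4 ≡ suc k * 2 * (k * 2)
  positive zero = refl
  positive (suc k) = begin
      (minMono (suc k * 2) + suc k * 2) * 4     ≡⟨ *-distribʳ-+ 4 (minMono (suc k * 2)) _ ⟩
      minMono (suc k * 2) * 4 + suc k * 2 * 4   ≡⟨ cong (_+ suc k * 2 * 4) (positive k) ⟩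
      suc k * 2 * (k * 2) + suc k * 2 * 4       ≡⟨ step k ⟩
      suc (suc k) * 2 * (suc k * 2)             ∎
    where open ≡-Reasoning

minMono-odd : ∀ m → minMono (suc (m * 2)) * 4 ≡ m * 2 * (m * 2)
minMono-odd zero = refl
minMono-odd (suc m) = begin
    (minMono (suc (m * 2)) + suc (m * 2)) * 4     ≡⟨ *-distribʳ-+ 4 (minMono (suc (m * 2))) _ ⟩
    minMono (suc (m * 2)) * 4 + suc (m * 2) * 4   ≡⟨ cong (_+ suc (m * 2) * 4) (minMono-odd m) ⟩
    m * 2 * (m * 2) + suc (m * 2) * 4             ≡⟨ step m ⟩
    suc m * 2 * (suc m * 2)                       ∎
  where
  open ≡-Reasoning
  step : ∀ k → k * 2 * (k * 2) + suc (k * 2) * 4 ≡ suc k * 2 * (suc k * 2)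
  step = solve-∀

minMono-closed-even : ∀ n → n % 2 ≡ 0 → (n * (n ∸ 2)) / 4 ≡ minMono n
minMono-closed-even n n%2≡0 = begin
    (n * (n ∸ 2)) / 4             ≡⟨ cong (λ k → (k * (k ∸ 2)) / 4) n≡2m ⟩
    (m * 2 * (m * 2 ∸ 2)) / 4     ≡⟨ cong (_/ 4) (sym (minMono-even m)) ⟩
    (minMono (m * 2) * 4) / 4     ≡⟨ m*n/n≡m (minMono (m * 2)) 4 ⟩
    minMono (m * 2)               ≡⟨ cong minMono (sym n≡2m) ⟩
    minMono n                     ∎
  where
  open ≡-Reasoning
  m = n / 2
  n≡2m : n ≡ m * 2
  n≡2m = trans (m≡m%n+[m/n]*n n 2) (cong (_+ m * 2) n%2≡0)

minMono-closed-odd : ∀ n → n % 2 ≡ 1 → ((n ∸ 1) * (n ∸ 1)) / 4 ≡ minMono n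
minMono-closed-odd n n%2≡1 = begin
    ((n ∸ 1) * (n ∸ 1)) / 4       ≡⟨ cong (λ k → ((k ∸ 1) * (k ∸ 1)) / 4) n≡2m+1 ⟩
    (m * 2 * (m * 2)) / 4         ≡⟨ cong (_/ 4) (sym (minMono-odd m)) ⟩
    (minMono (suc (m * 2)) * 4) / 4 ≡⟨ m*n/n≡m (minMono (suc (m * 2))) 4 ⟩
    minMono (suc (m * 2))         ≡⟨ cong minMono (sym n≡2m+1) ⟩
    minMono n                     ∎
  where
  open ≡-Reasoning
  m = n / 2
  n≡2m+1 : n ≡ suc (m * 2)
  n≡2m+1 = trans (m≡m%n+[m/n]*n n 2) (cong (_+ m * 2) n%2≡1)

Ω : ℕ → ℕ
Ω zero = 0
Ω (suc k) = length (factors (factorise (suc k)))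

Ω-factorisation : ∀ k (fa : PrimeFactorisation (suc k)) → Ω (suc k) ≡ length (factors fa)
Ω-factorisation k fa = ↭-length (factorisationUnique (factorise (suc k)) fa)

-- Multiplying by a prime adds one factor to a factorisation, so Ω grows by 1.
Ω-prime-* : ∀ {p} k → Prime p → Ω (p * suc k) ≡ suc (Ω (suc k))
Ω-prime-* {zero} k p-prime = contradiction p-prime ¬prime[0]
Ω-prime-* {suc p} k p-prime = Ω-factorisation (k + p * suc k) record
  { factors = suc p ∷ factors fk
  ; isFactorisation = cong (suc p *_) (PrimeFactorisation.isFactorisation fk)
  ; factorsPrime = p-prime ∷ PrimeFactorisation.factorsPrime fk
  }
  where fk = factorise (suc k)

parity-suc≢ : ∀ x → parity (suc x) ≢ parity x
parity-suc≢ x eq = p≢p⁻¹ (parity x) (trans (sym (suc-homo-⁻¹ x)) (cong _⁻¹ eq))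

ΩParity : ℕ → Parity
ΩParity d = parity (Ω d)

ΩParity-prime-multiple : ∀ {d e} → 1 ≤ d → IsPrimeMultiple e d → ΩParity e ≢ ΩParity d
ΩParity-prime-multiple {suc k} _ (p , p-prime , refl) eq =
  parity-suc≢ (Ω (suc k)) (trans (cong parity (sym (Ω-prime-* k p-prime))) eq)

primeRatio⇒ΩParity≢ : ∀ {d e} → 1 ≤ d → 1 ≤ e → PrimeRatio d e → ΩParity d ≢ ΩParity e
primeRatio⇒ΩParity≢ d≥1 _ (inj₁ e=pd) = ΩParity-prime-multiple d≥1 e=pd ∘ sym
primeRatio⇒ΩParity≢ _ e≥1 (inj₂ d=pe) = ΩParity-prime-multiple e≥1 d=pe

-- Every labelling of Kₙ by AP-sets (injective or not) has at least minMono n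
-- edges without prime deterministic ratio: its Ω-parity-monochromatic edges.
lower-bound : ∀ n (f : Fin n → APSet) → minMono n ≤ nonPrimeEdges n f
lower-bound n f = begin
    minMono n                          ≡⟨ cong minMono (sym (classes-partition n col)) ⟩
    minMono (s₀ + s₁)                  ≤⟨ minMono≤split s₀ s₁ ⟩
    pairs s₀ + pairs s₁                ≡⟨ sym (monochromatic-count n col) ⟩
    edgeCount n (monochromatic col)    ≤⟨ edgeCount-mono n (monochromatic col) _ monochromatic⇒nonPrime ⟩
    edgeCount n _                      ≡⟨ sym (nonPrimeEdges-edgeCount n f) ⟩
    nonPrimeEdges n f                  ∎
  where
  open ≤-Reasoning
  col : Colouring n
  col i = ΩParity (diff (f i))
  s₀ = classSize 0ℙ col
  s₁ = classSize 1ℙ col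
  monochromatic⇒nonPrime : ∀ u v → col u ≡ col v → ¬ PrimeRatio (diff (f u)) (diff (f v))
  monochromatic⇒nonPrime u v same ratio = primeRatio⇒ΩParity≢ (diff≥1 (f u)) (diff≥1 (f v)) ratio same

IsLeast : SetN → ℕ → Set
IsLeast S m = S m × (∀ x → S x → m ≤ x)

least-unique : ∀ {S T : SetN} {m k} → S ≐ T → IsLeast S m → IsLeast T k → m ≡ k
least-unique S≐T (m∈S , m≤S) (k∈T , k≤T) =
  ≤-antisym (m≤S _ (Equivalence.from (S≐T _) k∈T)) (k≤T _ (Equivalence.to (S≐T _) m∈S))

-- The start of an AP-set is its least element, and the two starts sum to the
-- least element of a sumset; this is how labels are recovered.
start-least : ∀ A → IsLeast (_∈AP A) (start A)
start-least A = (0 , <-≤-trans z<s (len≥3 A) , sym (+-identityʳ (start A)))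
              , λ { x (i , _ , x≡) → ≤-trans (m≤m+n (start A) (i * diff A)) (≤-reflexive (sym x≡)) }

sumSet-least : ∀ A C → IsLeast (SumSet A C) (start A + start C)
sumSet-least A C = (start A , start C , proj₁ (start-least A) , proj₁ (start-least C) , refl)
                 , λ { x (a , c , a∈A , c∈C , x≡) → ≤-trans (+-mono-≤ (proj₂ (start-least A) a a∈A)
                                                                     (proj₂ (start-least C) c c∈C))
                                                            (≤-reflexive (sym x≡)) }

ap3 : (s d : ℕ) → 1 ≤ d → APSet
ap3 s d d≥1 = ap s d 3 d≥1 ≤-refl

sumSet-comm : ∀ A C → SumSet A C ≐ SumSet C A
sumSet-comm A C x = mk⇔ (swap {A} {C}) (swap {C} {A})
  where
  swap : ∀ {A C} → SumSet A C x → SumSet C A x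
  swap (a , c , a∈A , c∈C , x≡) = c , a , c∈C , a∈A , trans x≡ (+-comm a c)

split5 : ∀ k → k < 5 → ∃[ i ] ∃[ j ] (i < 3 × j < 3 × k ≡ i + j)
split5 0 _ = 0 , 0 , z<s , z<s , refl
split5 1 _ = 1 , 0 , s<s z<s , z<s , refl
split5 2 _ = 2 , 0 , s<s (s<s z<s) , z<s , refl
split5 3 _ = 2 , 1 , s<s (s<s z<s) , s<s z<s , refl
split5 4 _ = 2 , 2 , s<s (s<s z<s) , s<s (s<s z<s) , refl
split5 (suc (suc (suc (suc (suc _))))) (s<s (s<s (s<s (s<s (s<s ())))))

split7 : ∀ k → k < 7 → ∃[ i ] ∃[ j ] (i < 3 × j < 3 × k ≡ i + 2 * j)
split7 0 _ = 0 , 0 , z<s , z<s , refl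
split7 1 _ = 1 , 0 , s<s z<s , z<s , refl
split7 2 _ = 0 , 1 , z<s , s<s z<s , refl
split7 3 _ = 1 , 1 , s<s z<s , s<s z<s , refl
split7 4 _ = 0 , 2 , z<s , s<s (s<s z<s) , refl
split7 5 _ = 1 , 2 , s<s z<s , s<s (s<s z<s) , refl
split7 6 _ = 2 , 2 , s<s (s<s z<s) , s<s (s<s z<s) , refl
split7 (suc (suc (suc (suc (suc (suc (suc _))))))) (s<s (s<s (s<s (s<s (s<s (s<s (s<s ())))))))

sumSet-sameStep : ∀ s t d (d≥1 : 1 ≤ d) →
  SumSet (ap3 s d d≥1) (ap3 t d d≥1) ≐ (_∈AP ap (s + t) d 5 d≥1 (m≤m+n 3 2))
sumSet-sameStep s t d d≥1 x = mk⇔ to from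
  where
  regroup : ∀ s t i j d → (s + i * d) + (t + j * d) ≡ s + t + (i + j) * d
  regroup = solve-∀
  to : SumSet (ap3 s d d≥1) (ap3 t d d≥1) x → x ∈AP ap (s + t) d 5 d≥1 (m≤m+n 3 2)
  to (_ , _ , (i , i<3 , refl) , (j , j<3 , refl) , x≡) =
    i + j , +-mono-≤ i<3 (s≤s⁻¹ j<3) , trans x≡ (regroup s t i j d)
  from : x ∈AP ap (s + t) d 5 d≥1 (m≤m+n 3 2) → SumSet (ap3 s d d≥1) (ap3 t d d≥1) x
  from (k , k<5 , x≡) with split5 k k<5
  ... | i , j , i<3 , j<3 , refl =
    s + i * d , t + j * d , (i , i<3 , refl) , (j , j<3 , refl) , trans x≡ (sym (regroup s t i j d))

sumSet-doubleStep : ∀ s t d (d≥1 : 1 ≤ d) (2d≥1 : 1 ≤ 2 * d) →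
  SumSet (ap3 s d d≥1) (ap3 t (2 * d) 2d≥1) ≐ (_∈AP ap (s + t) d 7 d≥1 (m≤m+n 3 4))
sumSet-doubleStep s t d d≥1 2d≥1 x = mk⇔ to from
  where
  regroup : ∀ s t i j d → (s + i * d) + (t + j * (2 * d)) ≡ s + t + (i + 2 * j) * d
  regroup = solve-∀
  to : SumSet (ap3 s d d≥1) (ap3 t (2 * d) 2d≥1) x → x ∈AP ap (s + t) d 7 d≥1 (m≤m+n 3 4)
  to (_ , _ , (i , i<3 , refl) , (j , j<3 , refl) , x≡) =
    i + 2 * j , +-mono-≤ i<3 (*-monoʳ-≤ 2 (s≤s⁻¹ j<3)) , trans x≡ (regroup s t i j d)
  from : x ∈AP ap (s + t) d 7 d≥1 (m≤m+n 3 4) → SumSet (ap3 s d d≥1) (ap3 t (2 * d) 2d≥1) x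
  from (k , k<7 , x≡) with split7 k k<7
  ... | i , j , i<3 , j<3 , refl =
    s + i * d , t + j * (2 * d) , (i , i<3 , refl) , (j , j<3 , refl) , trans x≡ (sym (regroup s t i j d))

2^-injective : ∀ {a b} → 2 ^ a ≡ 2 ^ b → a ≡ b
2^-injective {a} {b} eq with <-cmp a b
... | tri< a<b _ _ = contradiction eq (<⇒≢ (^-monoʳ-< 2 (s<s z<s) a<b))
... | tri≈ _ a≡b _ = a≡b
... | tri> _ _ b<a = contradiction (sym eq) (<⇒≢ (^-monoʳ-< 2 (s<s z<s) b<a))

-- 2ᵘ + 2ᵛ with u < v determines u and v (uniqueness of binary expansions).
powerSum-injective : ∀ {u v a b} → u < v → a < b → 2 ^ u + 2 ^ v ≡ 2 ^ a + 2 ^ b → u ≡ a × v ≡ b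
powerSum-injective {zero} {_} {zero} _ _ eq = refl , 2^-injective (suc-injective eq)
powerSum-injective {zero} {suc v} {suc a} {suc b} _ _ eq =
  contradiction (trans (*-distribˡ-+ 2 (2 ^ a) (2 ^ b)) (sym eq)) (even≢odd (2 ^ a + 2 ^ b) (2 ^ v))
powerSum-injective {suc u} {suc v} {zero} {suc b} _ _ eq =
  contradiction (trans (*-distribˡ-+ 2 (2 ^ u) (2 ^ v)) eq) (even≢odd (2 ^ u + 2 ^ v) (2 ^ b))
powerSum-injective {suc u} {suc v} {suc a} {suc b} (s<s u<v) (s<s a<b) eq =
  Product.map (cong suc) (cong suc) (powerSum-injective u<v a<b halved)
  where
  halved : 2 ^ u + 2 ^ v ≡ 2 ^ a + 2 ^ b
  halved = *-cancelˡ-≡ _ _ 2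
    (trans (*-distribˡ-+ 2 (2 ^ u) (2 ^ v)) (trans eq (sym (*-distribˡ-+ 2 (2 ^ a) (2 ^ b)))))

stepOf : Parity → ℕ
stepOf 0ℙ = 1
stepOf 1ℙ = 2

stepOf≥1 : ∀ c → 1 ≤ stepOf c
stepOf≥1 0ℙ = s≤s z≤n
stepOf≥1 1ℙ = s≤s z≤n

vertexLabel : Parity → ℕ → APSet
vertexLabel c s = ap3 s (stepOf c) (stepOf≥1 c)

powerLabelling : ∀ n → Fin n → APSet
powerLabelling n i = vertexLabel (parity (toℕ i)) (2 ^ toℕ i)

edgeLabel-AP : ∀ b c s t → ∃[ A ] (SumSet (vertexLabel b s) (vertexLabel c t) ≐ (_∈AP A))
edgeLabel-AP 0ℙ 0ℙ s t = ap (s + t) 1 5 (stepOf≥1 0ℙ) (m≤m+n 3 2) , sumSet-sameStep s t 1 (stepOf≥1 0ℙ)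
edgeLabel-AP 1ℙ 1ℙ s t = ap (s + t) 2 5 (stepOf≥1 1ℙ) (m≤m+n 3 2) , sumSet-sameStep s t 2 (stepOf≥1 1ℙ)
edgeLabel-AP 0ℙ 1ℙ s t = ap (s + t) 1 7 (stepOf≥1 0ℙ) (m≤m+n 3 4) , sumSet-doubleStep s t 1 (stepOf≥1 0ℙ) (stepOf≥1 1ℙ)
edgeLabel-AP 1ℙ 0ℙ s t = ap (t + s) 1 7 (stepOf≥1 0ℙ) (m≤m+n 3 4) , λ x →
  sumSet-doubleStep t s 1 (stepOf≥1 0ℙ) (stepOf≥1 1ℙ) x ⇔-∘ sumSet-comm (vertexLabel 1ℙ s) (vertexLabel 0ℙ t) x

-- Labels are distinct because their least elements 2ⁱ are, and edge labels
-- because their least elements 2ᵘ + 2ᵛ are.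
powerLabelling-AIASI : ∀ n → IsAIASI n (powerLabelling n)
powerLabelling-AIASI n = record
  { vertex-inj = λ u v same → toℕ-injective (2^-injective
      (least-unique same (start-least (L u)) (start-least (L v))))
  ; edge-inj = λ u v u' v' u<v u'<v' same → Product.map toℕ-injective toℕ-injective
      (powerSum-injective u<v u'<v' (least-unique same (sumSet-least (L u) (L v)) (sumSet-least (L u') (L v'))))
  ; edge-AP = λ u v _ → edgeLabel-AP _ _ _ _
  }
  where
  L = powerLabelling n

-- Equal steps never have prime ratio: d = p · d forces p = 1.
¬self-prime-multiple : ∀ {d} → 1 ≤ d → ¬ IsPrimeMultiple d d
¬self-prime-multiple {suc k} _ (p , p-prime , d≡pd) =
  ¬prime[1] (subst Prime (sym (*-cancelʳ-≡ 1 p (suc k) (trans (*-identityˡ (suc k)) d≡pd))) p-prime)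

sameParity⇒¬primeRatio : ∀ b c → b ≡ c → ¬ PrimeRatio (stepOf b) (stepOf c)
sameParity⇒¬primeRatio b .b refl =
  [ ¬self-prime-multiple (stepOf≥1 b) , ¬self-prime-multiple (stepOf≥1 b) ]

-- The steps 1 and 2 have the prime ratio 2.
¬primeRatio⇒sameParity : ∀ b c → ¬ PrimeRatio (stepOf b) (stepOf c) → b ≡ c
¬primeRatio⇒sameParity 0ℙ 0ℙ _ = refl
¬primeRatio⇒sameParity 1ℙ 1ℙ _ = refl
¬primeRatio⇒sameParity 0ℙ 1ℙ ¬ratio = contradiction (inj₁ (2 , prime[2] , refl)) ¬ratio
¬primeRatio⇒sameParity 1ℙ 0ℙ ¬ratio = contradiction (inj₂ (2 , prime[2] , refl)) ¬ratio

-- The non-prime edges of the construction are the parity-monochromatic ones.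
powerLabelling-count : ∀ n → nonPrimeEdges n (powerLabelling n) ≡ minMono n
powerLabelling-count n = begin
    nonPrimeEdges n (powerLabelling n)          ≡⟨ nonPrimeEdges-edgeCount n (powerLabelling n) ⟩
    edgeCount n _                               ≡⟨ edgeCount-cong n _ (monochromatic col)
                                                     (λ u v → ¬primeRatio⇒sameParity (col u) (col v))
                                                     (λ u v → sameParity⇒¬primeRatio (col u) (col v)) ⟩
    edgeCount n (monochromatic col)             ≡⟨ monochromatic-count n col ⟩
    pairs (classSize 0ℙ col) + pairs (classSize 1ℙ col)
                                                ≡⟨ parityColouring-optimal n ⟩
    minMono n                                   ∎
  where
  open ≡-Reasoning
  col = parityColouring n

dispensingNumber : ∀ n → IsDispensingNumberK n (minMono n)
dispensingNumber n =
  (powerLabelling n , powerLabelling-AIASI n , powerLabelling-count n) , (λ f _ → lower-bound n f)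

theorem3p4 : ∀ (n : ℕ) →
    (n % 2 ≡ 0 → IsDispensingNumberK n ((n * (n ∸ 2)) / 4)) ×
    (n % 2 ≡ 1 → IsDispensingNumberK n (((n ∸ 1) * (n ∸ 1)) / 4))
theorem3p4 n =
    (λ even → subst (IsDispensingNumberK n) (sym (minMono-closed-even n even)) (dispensingNumber n))
  , (λ odd → subst (IsDispensingNumberK n) (sym (minMono-closed-odd n odd)) (dispensingNumber n))
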